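{- Let $\{U_n\}_{n\ge0}$ be defined by $U_0=0$, $U_1=1$, $U_{n+2}=6U_{n+1}-U_n$. For a positive integer $m$, let $z(m)$ be the smallest $n\ge1$ with $m\mid U_n$. Let $p$ be an odd prime and $b\ge1$ an integer. Then $$z(p^b)\ \Big|\ p^{b-1}\Big(p-\Big(\frac{2}{p}\Big)\Big)/2,$$ where $\big(\frac{2}{p}\big)$ is the Legendre symbol.
   Context: The index of appearance $z(m)$ exists for every positive integer $m$. -}

module Defs where

open import Data.Nat as ℕ using (ℕ; zero; suc)
open import Data.Integer as ℤ using (ℤ; +_; _-_; _*_)
open import Data.Integer.Divisibility using (_∣_)
open import Data.Product using (∃; _×_)
open import Relation.Nullary using (¬_)

U : ℕ → ℤ
U zero = + 0
U (suc zero) = + 1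
U (suc (suc n)) = + 6 * U (suc n) - U n

IsIndexOfAppearance : ℕ → ℕ → Set
IsIndexOfAppearance m n =
  1 ℕ.≤ n × (+ m) ∣ U n × (∀ k → 1 ℕ.≤ k → (+ m) ∣ U k → n ℕ.≤ k)

QR2 : ℕ → Set
QR2 p = ∃ λ (x : ℤ) → (+ p) ∣ (x * x - + 2)

-- Legendre symbol (2/p) for an odd prime p (p ∤ 2), as a relation:
-- Legendre2 p s  means  (2/p) = s
data Legendre2 (p : ℕ) : ℤ → Set where
  residue    : QR2 p → Legendre2 p (+ 1)
  nonresidue : ¬ QR2 p → Legendre2 p (ℤ.- (+ 1))

module Submission where

-- The proof has three ingredients.
--  1. Divisibility properties of U (from the addition formula): U(jn+1) is
--     a unit modulo U(n), so m ∣ U(M) forces z(m) ∣ M (appearance-divides);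
--     and U(pn) ≡ p U(n) U(n+1)^(p-1) modulo U(n)², so p^k ∣ U(n) lifts to
--     p^(k+1) ∣ U(pn) (lift).
--  2. The base case p ∣ U((p - (2/p)) / 2) (half-index).  Writing
--     (1 + √2)^n = E(n) + O(n) √2 one has O(2n) = 2 U(n); by the binomial
--     theorem modulo p, (1 + √2)^p ≡ 1 + 2^((p-1)/2) √2, and Euler's
--     criterion 2^((p-1)/2) ≡ (2/p) then makes O(p ∓ 1) ≡ 0.
--  3. Euler's criterion for 2 and Wilson's theorem, both obtained by pairing
--     each nonzero residue x with the residue a/x (pair-off).
-- The theorem follows: p ∣ U(m) with 2m = p - (2/p) lifts to
-- p^b ∣ U(p^(b-1) m), hence z(p^b) ∣ p^(b-1) m = N.

open import Defs
open import Data.Nat using (ℕ; _≤_; _^_; _∸_)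
open import Data.Nat.Primality using (Prime)
open import Data.Integer using (ℤ; +_; _-_; _*_)
open import Data.Integer.Divisibility using (_∣_)
open import Relation.Binary.PropositionalEquality using (_≡_; _≢_)

open import Data.Empty using (⊥-elim)
open import Data.Integer using (_+_; -_)
import Data.Integer as ℤ
open import Data.Integer.Divisibility.Signed as Signed using (divides) renaming (_∣_ to _∣ₛ_)
open import Data.Integer.DivMod using (_%ℕ_; _/ℕ_; n%ℕd<d; a≡a%ℕn+[a/ℕn]*n)
import Data.Integer.Properties as ℤP
open import Data.Integer.Tactic.RingSolver using (solve-∀)
open import Data.List using (List; []; _∷_; length; applyUpTo)
open import Data.List.Membership.Propositional using (_∈_)
open import Data.List.Membership.Propositional.Properties using (∈-applyUpTo⁺; ∈-applyUpTo⁻)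
open import Data.List.Properties using (length-applyUpTo; length-removeAt′)
open import Data.List.Relation.Unary.All as All using (All)
import Data.List.Relation.Unary.All.Properties as All
open import Data.List.Relation.Unary.AllPairs using (_∷_)
open import Data.List.Relation.Unary.Any using (here; there; _─_; index)
open import Data.List.Relation.Unary.Unique.Propositional using (Unique)
open import Data.List.Relation.Unary.Unique.Propositional.Properties using (applyUpTo⁺₁)
open import Data.Nat using (suc; zero; _<_)
import Data.Nat as ℕ
open import Data.Nat.Combinatorics using (_C_; nCn≡1; nC1≡n; nCk+nC[k+1]≡[n+1]C[k+1])
open import Data.Nat.Combinatorics.Specification using (k>n⇒nCk≡0)
open import Data.Nat.Coprimality using (prime⇒coprime; coprime-Bézout)
open import Data.Nat.Divisibility as ℕD using () renaming (_∣_ to _∣ℕ_)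
open import Data.Nat.DivMod using (_%_; _/_; m%n<n; m≡m%n+[m/n]*n)
import Data.Nat.GCD as ℕGCD
open import Data.Nat.ListAction using (product)
open import Data.Nat.Primality using (euclidsLemma; ¬prime[1]; prime⇒nonZero; prime⇒irreducible)
import Data.Nat.Properties as ℕP
open import Algebra.Properties.CommutativeSemigroup ℕP.*-commutativeSemigroup using (x∙yz≈y∙xz)
import Data.Nat.Tactic.RingSolver as ℕSolver
open import Data.Product using (Σ; _×_; _,_; proj₁; proj₂)
open import Data.Sum using (_⊎_; inj₁; inj₂; [_,_]′)
open import Function using (_∘_)
open import Relation.Binary.Bundles using (Setoid)
open import Relation.Binary.PropositionalEquality using (refl; sym; trans; cong; cong₂; subst; module ≡-Reasoning)
open import Relation.Nullary using (¬_)

infix 4 _≡_[mod_]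

-- Congruence modulo d.  It is a record rather than a bare divisibility
-- statement so that a, b and d can be read off from its type.
record _≡_[mod_] (a b d : ℤ) : Set where
  constructor mod
  field modulus-divides : d ∣ₛ a - b
open _≡_[mod_] public

∣-by : ∀ {d x y} → x ≡ y → d ∣ₛ y → d ∣ₛ x
∣-by refl d∣y = d∣y

∣-zero : ∀ d → d ∣ₛ + 0
∣-zero d = divides (+ 0) (sym (ℤP.*-zeroˡ d))

mod-combination : ∀ {d a b x y} u v → a - b ≡ u * x + v * y →
                  d ∣ₛ x → d ∣ₛ y → a ≡ b [mod d ]
mod-combination u v eq d∣x d∣y =
  mod (∣-by eq (Signed.∣m∣n⇒∣m+n (Signed.∣n⇒∣m*n u d∣x) (Signed.∣n⇒∣m*n v d∣y)))

mod-reflexive : ∀ {d a b} → a ≡ b → a ≡ b [mod d ]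
mod-reflexive {d} {a} refl = mod (∣-by (ℤP.+-inverseʳ a) (∣-zero d))

mod-refl : ∀ {d} a → a ≡ a [mod d ]
mod-refl a = mod-reflexive refl

mod-sym : ∀ {d a b} → a ≡ b [mod d ] → b ≡ a [mod d ]
mod-sym {d} {a} {b} (mod d∣a-b) = mod-combination (- + 1) (+ 0) (identity a b) d∣a-b (∣-zero d)
  where identity : ∀ a b → b - a ≡ - + 1 * (a - b) + + 0 * + 0
        identity = solve-∀

mod-trans : ∀ {d a b c} → a ≡ b [mod d ] → b ≡ c [mod d ] → a ≡ c [mod d ]
mod-trans {d} {a} {b} {c} (mod h₁) (mod h₂) = mod-combination (+ 1) (+ 1) (identity a b c) h₁ h₂
  where identity : ∀ a b c → a - c ≡ + 1 * (a - b) + + 1 * (b - c)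
        identity = solve-∀

mod-setoid : ℤ → Setoid _ _
mod-setoid d = record
  { Carrier       = ℤ
  ; _≈_           = λ a b → a ≡ b [mod d ]
  ; isEquivalence = record { refl = mod-refl _ ; sym = mod-sym ; trans = mod-trans }
  }

module ≡-mod-Reasoning (d : ℤ) where
  open import Relation.Binary.Reasoning.Setoid (mod-setoid d) public

mod-+ : ∀ {d a b c e} → a ≡ b [mod d ] → c ≡ e [mod d ] → a + c ≡ b + e [mod d ]
mod-+ {d} {a} {b} {c} {e} (mod h₁) (mod h₂) = mod-combination (+ 1) (+ 1) (identity a b c e) h₁ h₂
  where identity : ∀ a b c e → (a + c) - (b + e) ≡ + 1 * (a - b) + + 1 * (c - e)
        identity = solve-∀

mod-- : ∀ {d a b c e} → a ≡ b [mod d ] → c ≡ e [mod d ] → a - c ≡ b - e [mod d ]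
mod-- {d} {a} {b} {c} {e} (mod h₁) (mod h₂) = mod-combination (+ 1) (- + 1) (identity a b c e) h₁ h₂
  where identity : ∀ a b c e → (a - c) - (b - e) ≡ + 1 * (a - b) + - + 1 * (c - e)
        identity = solve-∀

mod-neg : ∀ {d a b} → a ≡ b [mod d ] → - a ≡ - b [mod d ]
mod-neg {d} {a} {b} (mod h) = mod-combination (- + 1) (+ 0) (identity a b) h (∣-zero d)
  where identity : ∀ a b → - a - - b ≡ - + 1 * (a - b) + + 0 * + 0
        identity = solve-∀

mod-* : ∀ {d a b c e} → a ≡ b [mod d ] → c ≡ e [mod d ] → a * c ≡ b * e [mod d ]
mod-* {d} {a} {b} {c} {e} (mod h₁) (mod h₂) = mod-combination c b (identity a b c e) h₁ h₂
  where identity : ∀ a b c e → a * c - b * e ≡ c * (a - b) + b * (c - e)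
        identity = solve-∀

mod-*-comm : ∀ {d a} u v → u * v ≡ a [mod d ] → v * u ≡ a [mod d ]
mod-*-comm u v = mod-trans (mod-reflexive (ℤP.*-comm v u))

mod-scale : ∀ {d a b} c → a ≡ b [mod d ] → c * a ≡ c * b [mod c * d ]
mod-scale {d} {a} {b} c (mod (divides q eq)) = mod (divides q (begin
    c * a - c * b  ≡⟨ distrib a b c ⟩
    c * (a - b)    ≡⟨ cong (c *_) eq ⟩
    c * (q * d)    ≡⟨ swap c q d ⟩
    q * (c * d)    ∎))
  where
    open ≡-Reasoning
    distrib : ∀ a b c → c * a - c * b ≡ c * (a - b)
    distrib = solve-∀
    swap : ∀ c q d → c * (q * d) ≡ q * (c * d)
    swap = solve-∀

mod-weaken : ∀ {d e a b} → e ∣ₛ d → a ≡ b [mod d ] → a ≡ b [mod e ]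
mod-weaken e∣d (mod d∣a-b) = mod (Signed.∣-trans e∣d d∣a-b)

∣⇒≡0 : ∀ {d a} → d ∣ₛ a → a ≡ + 0 [mod d ]
∣⇒≡0 {d} {a} d∣a = mod (∣-by (ℤP.+-identityʳ a) d∣a)

≡0⇒∣ : ∀ {d a} → a ≡ + 0 [mod d ] → d ∣ₛ a
≡0⇒∣ {d} {a} (mod h) = ∣-by (sym (ℤP.+-identityʳ a)) h

multiple≡0 : ∀ d q → d * q ≡ + 0 [mod d ]
multiple≡0 d q = ∣⇒≡0 (Signed.∣m⇒∣m*n q (Signed.∣-refl {d}))

mod-unit-^ : ∀ {d a c} j → a * c ≡ + 1 [mod d ] → a ℤ.^ j * c ℤ.^ j ≡ + 1 [mod d ]
mod-unit-^ zero    _ = mod-refl (+ 1)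
mod-unit-^ {d} {a} {c} (suc j) ac≡1 = begin
  a * a ℤ.^ j * (c * c ℤ.^ j)    ≡⟨ regroup a c (a ℤ.^ j) (c ℤ.^ j) ⟩
  (a * c) * (a ℤ.^ j * c ℤ.^ j)  ≈⟨ mod-* ac≡1 (mod-unit-^ j ac≡1) ⟩
  + 1 * + 1                      ≡⟨⟩
  + 1                            ∎
  where
    open ≡-mod-Reasoning d
    regroup : ∀ a c x y → a * x * (c * y) ≡ (a * c) * (x * y)
    regroup = solve-∀

U-add : ∀ m n → U (suc (m ℕ.+ n)) ≡ U (suc m) * U (suc n) - U m * U n
U-add zero n = base (U (suc n)) (U n)
  where base : ∀ x y → x ≡ + 1 * x - + 0 * y
        base = solve-∀
U-add (suc zero) n = base (U (suc n)) (U n)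
  where base : ∀ x y → + 6 * x - y ≡ + 6 * x - + 1 * y
        base = solve-∀
U-add (suc (suc m)) n = begin
    + 6 * U (suc (suc (m ℕ.+ n))) - U (suc (m ℕ.+ n))
      ≡⟨ cong₂ (λ x y → + 6 * x - y) (U-add (suc m) n) (U-add m n) ⟩
    + 6 * (U (suc (suc m)) * c - U (suc m) * e) - (U (suc m) * c - U m * e)
      ≡⟨ step (U m) (U (suc m)) c e ⟩
    U (suc (suc (suc m))) * c - U (suc (suc m)) * e ∎
  where
    open ≡-Reasoning
    c e : ℤ
    c = U (suc n)
    e = U n
    step : ∀ a₀ a₁ c e →
      + 6 * ((+ 6 * a₁ - a₀) * c - a₁ * e) - (a₁ * c - a₀ * e)
        ≡ (+ 6 * (+ 6 * a₁ - a₀) - a₁) * c - (+ 6 * a₁ - a₀) * e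
    step = solve-∀

-- Cassini-type identity  U(n + 2) U(n) - U(n + 1)² = -1: the quantity is
-- invariant under the shift n ↦ n + 1.
U-cassini : ∀ n → U (suc (suc n)) * U n - U (suc n) * U (suc n) ≡ - + 1
U-cassini zero    = refl
U-cassini (suc n) = trans (shift (U n) (U (suc n))) (U-cassini n)
  where shift : ∀ a b → (+ 6 * (+ 6 * b - a) - b) * b - (+ 6 * b - a) * (+ 6 * b - a)
                        ≡ (+ 6 * b - a) * a - b * b
        shift = solve-∀

-- The terms of U at multiples of a fixed index n = n₀ + 1, expressed through
-- T = U(n), A = U(n + 1) and B = U(n - 1); note A = 6T - B by definition.
module Multiples (n₀ : ℕ) where
  n : ℕ
  n = suc n₀
  T A B : ℤ
  T = U n
  A = U (suc n)
  B = U n₀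

  -- A is a unit modulo T with inverse -B, since A B = T² - 1 (Cassini).
  A-unit : A * (- B) ≡ + 1 [mod T ]
  A-unit = begin
    A * (- B)                        ≡⟨ expand A B T ⟩
    - (A * B - T * T) - T * T        ≡⟨ cong (λ x → - x - T * T) (U-cassini n₀) ⟩
    - (- + 1) - T * T                ≈⟨ mod-- (mod-refl (- (- + 1))) (multiple≡0 T T) ⟩
    + 1                              ∎
    where
      open ≡-mod-Reasoning T
      expand : ∀ a b t → a * (- b) ≡ - (a * b - t * t) - t * t
      expand = solve-∀

  U[jn+1]≡A^j : ∀ j → U (suc (j ℕ.* n)) ≡ A ℤ.^ j [mod T ]
  U[jn+1]≡A^j zero    = mod-refl (+ 1)
  U[jn+1]≡A^j (suc j) = begin
    U (suc (n ℕ.+ j ℕ.* n))                    ≡⟨ U-add n (j ℕ.* n) ⟩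
    A * U (suc (j ℕ.* n)) - T * U (j ℕ.* n)
      ≈⟨ mod-- (mod-* (mod-refl A) (U[jn+1]≡A^j j)) (multiple≡0 T (U (j ℕ.* n))) ⟩
    A * A ℤ.^ j - + 0                           ≡⟨ ℤP.+-identityʳ (A * A ℤ.^ j) ⟩
    A ℤ.^ suc j                                 ∎
    where open ≡-mod-Reasoning T

  U[jn]≡jTA^j : ∀ j → U (suc j ℕ.* n) ≡ + suc j * T * A ℤ.^ j [mod T * T ]
  U[jn]≡jTA^j zero = mod-reflexive (trans (cong U (ℕP.+-identityʳ n)) (unit T))
    where unit : ∀ t → t ≡ + 1 * t * + 1
          unit = solve-∀
  U[jn]≡jTA^j (suc j) = begin
    U (suc (n₀ ℕ.+ suc j ℕ.* n))                     ≡⟨ U-add n₀ (suc j ℕ.* n) ⟩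
    T * U (suc (suc j ℕ.* n)) - B * U (suc j ℕ.* n)
      ≈⟨ mod-- (mod-scale T (U[jn+1]≡A^j (suc j))) (mod-* (mod-refl B) (U[jn]≡jTA^j j)) ⟩
    T * A ℤ.^ suc j - B * (+ suc j * T * A ℤ.^ j)
      ≈⟨ mod-combination (- + 6 * + suc j * A ℤ.^ j) (+ 0) (collect T B (A ℤ.^ j) (+ suc j))
                         (Signed.∣-refl {T * T}) (∣-zero (T * T)) ⟩
    + suc (suc j) * T * A ℤ.^ suc j                  ∎
    where
      open ≡-mod-Reasoning (T * T)
      -- uses A = 6T - B
      collect : ∀ t b x j →
        t * ((+ 6 * t - b) * x) - b * (j * t * x) - (+ 1 + j) * t * ((+ 6 * t - b) * x)
          ≡ (- + 6 * j * x) * (t * t) + + 0 * + 0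
      collect = solve-∀

  T∣U[jn] : ∀ j → T ∣ₛ U (j ℕ.* n)
  T∣U[jn] zero    = ∣-zero T
  T∣U[jn] (suc j) = ≡0⇒∣ (mod-trans (mod-weaken T∣T² (U[jn]≡jTA^j j)) jTA^j≡0)
    where
      T∣T² : T ∣ₛ T * T
      T∣T² = Signed.∣m⇒∣m*n T (Signed.∣-refl {T})
      jTA^j≡0 : + suc j * T * A ℤ.^ j ≡ + 0 [mod T ]
      jTA^j≡0 = ∣⇒≡0 (Signed.∣m⇒∣m*n (A ℤ.^ j) (Signed.∣n⇒∣m*n (+ suc j) (Signed.∣-refl {T})))

  U[jn+1]-unit : ∀ j → U (suc (j ℕ.* n)) * (- B) ℤ.^ j ≡ + 1 [mod T ]
  U[jn+1]-unit j =
    mod-trans (mod-* (U[jn+1]≡A^j j) (mod-refl ((- B) ℤ.^ j))) (mod-unit-^ j A-unit)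

-- Write
-- M = qz + r; then U(M) = U(r) U(qz + 1) - U(r - 1) U(qz), where m ∣ U(qz)
-- and U(qz + 1) is a unit modulo U(z), hence modulo m.  So m ∣ U(r), and
-- minimality of z leaves only r = 0.
appearance-divides : ∀ {m z} M → IsIndexOfAppearance m z → + m ∣ U M → z ∣ℕ M
appearance-divides {m} {suc z₀} M (_ , m∣Uz , minimal) m∣UM
  with M % suc z₀ | m%n<n M (suc z₀) | m≡m%n+[m/n]*n M (suc z₀)
... | zero   | _   | M≡qz   = ℕD.divides (M / suc z₀) M≡qz
... | suc r₀ | r<z | M≡r+qz =
  ⊥-elim (ℕP.<⇒≱ r<z (minimal (suc r₀) (ℕ.s≤s ℕ.z≤n) (Signed.∣⇒∣ᵤ m∣U[r])))
  where
    open Multiples z₀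
    open ≡-mod-Reasoning (+ m)
    q qz : ℕ
    q  = M / suc z₀
    qz = q ℕ.* suc z₀
    m∣T : + m ∣ₛ T
    m∣T = Signed.∣ᵤ⇒∣ m∣Uz
    U[qz]≡0 : U r₀ * U qz ≡ + 0 [mod + m ]
    U[qz]≡0 = ∣⇒≡0 (Signed.∣n⇒∣m*n (U r₀) (Signed.∣-trans m∣T (T∣U[jn] q)))
    U[r]U[qz+1]≡0 : U (suc r₀) * U (suc qz) ≡ + 0 [mod + m ]
    U[r]U[qz+1]≡0 = begin
      U (suc r₀) * U (suc qz)                ≡⟨ ℤP.+-identityʳ (U (suc r₀) * U (suc qz)) ⟨
      U (suc r₀) * U (suc qz) - + 0
        ≈⟨ mod-- (mod-refl (U (suc r₀) * U (suc qz))) (mod-sym U[qz]≡0) ⟩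
      U (suc r₀) * U (suc qz) - U r₀ * U qz  ≡⟨ U-add r₀ qz ⟨
      U (suc (r₀ ℕ.+ qz))                    ≡⟨ cong U M≡r+qz ⟨
      U M                                    ≈⟨ ∣⇒≡0 (Signed.∣ᵤ⇒∣ m∣UM) ⟩
      + 0                                    ∎
    m∣U[r] : + m ∣ₛ U (suc r₀)
    m∣U[r] = ≡0⇒∣ (begin
      U (suc r₀)                             ≡⟨ ℤP.*-identityʳ (U (suc r₀)) ⟨
      U (suc r₀) * + 1
        ≈⟨ mod-* (mod-refl (U (suc r₀))) (mod-sym (mod-weaken m∣T (U[jn+1]-unit q))) ⟩
      U (suc r₀) * (U (suc qz) * C)          ≡⟨ ℤP.*-assoc (U (suc r₀)) (U (suc qz)) C ⟨
      U (suc r₀) * U (suc qz) * C            ≈⟨ mod-* U[r]U[qz+1]≡0 (mod-refl C) ⟩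
      + 0 * C                                ≡⟨ ℤP.*-zeroˡ C ⟩
      + 0                                    ∎)
      where C : ℤ
            C = (- B) ℤ.^ q

-- Lifting the exponent: if p^(k+1) ∣ U(n) then p^(k+2) ∣ U(pn), because
-- U(pn) ≡ p U(n) U(n + 1)^(p-1) modulo U(n)², and p U(n) ∣ U(n)².
lift-step : ∀ p k n → + (p ^ suc k) ∣ₛ U n → + (p ^ suc (suc k)) ∣ₛ U (p ℕ.* n)
lift-step zero    k n        _ = ∣-zero _
lift-step (suc j) k zero     _ rewrite ℕP.*-zeroʳ j = ∣-zero _
lift-step (suc j) k (suc n₀) pᵏ⁺¹∣T = Signed.∣-trans pᵏ⁺²∣pT pT∣U[pn]
  where
    open Multiples n₀
    p : ℕ
    p = suc j
    P : ℤ
    P = + p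
    p∣T : P ∣ₛ T
    p∣T = Signed.∣-trans (Signed.∣ᵤ⇒∣ (ℕD.m∣m*n (p ^ k))) pᵏ⁺¹∣T
    pᵏ⁺²∣pT : + (p ^ suc (suc k)) ∣ₛ P * T
    pᵏ⁺²∣pT = subst (Signed._∣ P * T) (sym (ℤP.pos-* p (p ^ suc k))) (Signed.*-monoʳ-∣ P pᵏ⁺¹∣T)
    pT∣U[pn] : P * T ∣ₛ U (p ℕ.* n)
    pT∣U[pn] = ≡0⇒∣ (mod-trans (mod-weaken (Signed.*-monoˡ-∣ T p∣T) (U[jn]≡jTA^j j))
                               (multiple≡0 (P * T) (A ℤ.^ j)))

lift : ∀ p m j → + p ∣ₛ U m → + (p ^ suc j) ∣ₛ U (p ^ j ℕ.* m)
lift p m zero p∣Um =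
  ∣-by (cong U (ℕP.+-identityʳ m)) (subst (λ x → + x ∣ₛ U m) (sym (ℕP.*-identityʳ p)) p∣Um)
lift p m (suc j) p∣Um =
  ∣-by (cong U (ℕP.*-assoc p (p ^ j) m)) (lift-step p j (p ^ j ℕ.* m) (lift p m j p∣Um))

∑ : ℕ → (ℕ → ℤ) → ℤ
∑ zero    f = + 0
∑ (suc n) f = f 0 + ∑ n (f ∘ suc)

∑-cong : ∀ n {f g} → (∀ k → f k ≡ g k) → ∑ n f ≡ ∑ n g
∑-cong zero    f≡g = refl
∑-cong (suc n) f≡g = cong₂ _+_ (f≡g 0) (∑-cong n (f≡g ∘ suc))

∑-+ : ∀ n f g → ∑ n (λ k → f k + g k) ≡ ∑ n f + ∑ n g
∑-+ zero    f g = refl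
∑-+ (suc n) f g = trans (cong (_+_ (f 0 + g 0)) (∑-+ n (f ∘ suc) (g ∘ suc)))
                        (swap (f 0) (g 0) (∑ n (f ∘ suc)) (∑ n (g ∘ suc)))
  where swap : ∀ a b c d → a + b + (c + d) ≡ a + c + (b + d)
        swap = solve-∀

∑-* : ∀ n c f → ∑ n (λ k → c * f k) ≡ c * ∑ n f
∑-* zero    c f = sym (ℤP.*-zeroʳ c)
∑-* (suc n) c f = trans (cong (_+_ (c * f 0)) (∑-* n c (f ∘ suc)))
                        (sym (ℤP.*-distribˡ-+ c (f 0) (∑ n (f ∘ suc))))

∑-last : ∀ n f → ∑ (suc n) f ≡ ∑ n f + f n
∑-last zero    f = trans (ℤP.+-identityʳ (f 0)) (sym (ℤP.+-identityˡ (f 0)))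
∑-last (suc n) f = trans (cong (_+_ (f 0)) (∑-last n (f ∘ suc)))
                         (sym (ℤP.+-assoc (f 0) (∑ n (f ∘ suc)) (f (suc n))))

∑≡0 : ∀ {d} n f → (∀ k → k < n → f k ≡ + 0 [mod d ]) → ∑ n f ≡ + 0 [mod d ]
∑≡0 zero    f _   = mod-refl (+ 0)
∑≡0 (suc n) f f≡0 =
  mod-+ (f≡0 0 (ℕ.s≤s ℕ.z≤n)) (∑≡0 n (f ∘ suc) (λ k k<n → f≡0 (suc k) (ℕ.s≤s k<n)))

-- The binomial transform  B f n = ∑_{k ≤ n} C(n, k) f(k).  With f(k) the
-- coordinates of x^k this is the binomial expansion of (1 + x)^n.
binomialSum : (ℕ → ℤ) → ℕ → ℤ
binomialSum f n = ∑ (suc n) (λ k → + (n C k) * f k)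

binomialSum-* : ∀ c f n → binomialSum (λ k → c * f k) n ≡ c * binomialSum f n
binomialSum-* c f n =
  trans (∑-cong (suc n) (λ k → swap (+ (n C k)) c (f k))) (∑-* (suc n) c (λ k → + (n C k) * f k))
  where swap : ∀ a c x → a * (c * x) ≡ c * (a * x)
        swap = solve-∀

binomialSum-suc : ∀ f n → binomialSum f (suc n) ≡ binomialSum f n + binomialSum (f ∘ suc) n
binomialSum-suc f n = begin
  + 1 * f 0 + ∑ (suc n) (λ k → + (suc n C suc k) * f (suc k))
    ≡⟨ cong (_+_ (+ 1 * f 0)) (trans (∑-cong (suc n) pascal) (∑-+ (suc n) shifted lower)) ⟩
  + 1 * f 0 + (∑ (suc n) shifted + ∑ (suc n) lower)
    ≡⟨ regroup (+ 1 * f 0) (∑ (suc n) shifted) (∑ (suc n) lower) ⟩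
  (+ 1 * f 0 + ∑ (suc n) lower) + ∑ (suc n) shifted
    ≡⟨ cong (λ x → (+ 1 * f 0 + x) + ∑ (suc n) shifted) (trans (∑-last n lower) top-vanishes) ⟩
  binomialSum f n + binomialSum (f ∘ suc) n ∎
  where
    open ≡-Reasoning
    shifted lower : ℕ → ℤ
    shifted k = + (n C k) * f (suc k)
    lower   k = + (n C suc k) * f (suc k)
    pascal : ∀ k → + (suc n C suc k) * f (suc k) ≡ shifted k + lower k
    pascal k = trans (cong (λ c → + c * f (suc k)) (sym (nCk+nC[k+1]≡[n+1]C[k+1] n k)))
                     (trans (cong (_* f (suc k)) (ℤP.pos-+ (n C k) (n C suc k)))
                            (ℤP.*-distribʳ-+ (f (suc k)) (+ (n C k)) (+ (n C suc k))))
    regroup : ∀ a x y → a + (x + y) ≡ (a + y) + x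
    regroup = solve-∀
    top-vanishes : ∑ n lower + lower n ≡ ∑ n lower
    top-vanishes = trans (cong (λ c → ∑ n lower + + c * f (suc n)) (k>n⇒nCk≡0 (ℕP.n<1+n n)))
                         (trans (cong (_+_ (∑ n lower)) (ℤP.*-zeroˡ (f (suc n))))
                                (ℤP.+-identityʳ (∑ n lower)))

absorption : ∀ n k → suc k ℕ.* (suc n C suc k) ≡ suc n ℕ.* (n C k)
absorption zero    zero    = refl
absorption zero    (suc k) = ℕP.*-zeroʳ (suc (suc k))
absorption (suc n) zero    = trans (ℕP.*-identityˡ (suc (suc n) C 1))
                                   (trans (nC1≡n (suc (suc n))) (sym (ℕP.*-identityʳ (suc (suc n)))))
absorption (suc n) (suc k) = begin
  suc (suc k) ℕ.* (suc (suc n) C suc (suc k))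
    ≡⟨ cong (suc (suc k) ℕ.*_) (sym (nCk+nC[k+1]≡[n+1]C[k+1] (suc n) (suc k))) ⟩
  suc (suc k) ℕ.* (a ℕ.+ b)
    ≡⟨ split k a b ⟩
  a ℕ.+ (suc k ℕ.* a ℕ.+ suc (suc k) ℕ.* b)
    ≡⟨ cong (a ℕ.+_) (cong₂ ℕ._+_ (absorption n k) (absorption n (suc k))) ⟩
  a ℕ.+ (suc n ℕ.* (n C k) ℕ.+ suc n ℕ.* (n C suc k))
    ≡⟨ cong (a ℕ.+_) (trans (sym (ℕP.*-distribˡ-+ (suc n) (n C k) (n C suc k)))
                           (cong (suc n ℕ.*_) (nCk+nC[k+1]≡[n+1]C[k+1] n k))) ⟩
  a ℕ.+ suc n ℕ.* a
    ≡⟨⟩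
  suc (suc n) ℕ.* a ∎
  where
    open ≡-Reasoning
    a b : ℕ
    a = suc n C suc k
    b = suc n C suc (suc k)
    split : ∀ k a b → suc (suc k) ℕ.* (a ℕ.+ b) ≡ a ℕ.+ (suc k ℕ.* a ℕ.+ suc (suc k) ℕ.* b)
    split = ℕSolver.solve-∀

prime∣C : ∀ {p k} → Prime p → 0 < k → k < p → p ∣ℕ p C k
prime∣C {suc n} {suc k} isPrime _ k<p with euclidsLemma (suc k) (suc n C suc k) isPrime
  (ℕD.divides (n C k) (trans (absorption n k) (ℕP.*-comm (suc n) (n C k))))
... | inj₁ p∣k  = ⊥-elim (ℕP.<⇒≱ k<p (ℕD.∣⇒≤ p∣k))
... | inj₂ p∣C = p∣C

binomialSum-prime : ∀ {p} → Prime p → ∀ f → binomialSum f p ≡ f 0 + f p [mod + p ]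
binomialSum-prime {suc n} isPrime f = begin
  + 1 * f 0 + ∑ (suc n) middle                 ≡⟨ cong (_+_ (+ 1 * f 0)) (∑-last n middle) ⟩
  + 1 * f 0 + (∑ n middle + middle n)
    ≈⟨ mod-+ (mod-refl (+ 1 * f 0)) (mod-+ inner≡0 (mod-refl (middle n))) ⟩
  + 1 * f 0 + (+ 0 + + (p C p) * f p)
    ≡⟨ cong (λ c → + 1 * f 0 + (+ 0 + + c * f p)) (nCn≡1 p) ⟩
  + 1 * f 0 + (+ 0 + + 1 * f p)                ≡⟨ clean (f 0) (f p) ⟩
  f 0 + f p                                    ∎
  where
    open ≡-mod-Reasoning (+ suc n)
    p : ℕ
    p = suc n
    middle : ℕ → ℤ
    middle k = + (p C suc k) * f (suc k)
    C≡0 : ∀ k → k < n → + (p C suc k) ≡ + 0 [mod + p ]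
    C≡0 k k<n =
      ∣⇒≡0 (Signed.∣ᵤ⇒∣ {+ p} {+ (p C suc k)} (prime∣C isPrime (ℕ.s≤s ℕ.z≤n) (ℕ.s≤s k<n)))
    inner≡0 : ∑ n middle ≡ + 0 [mod + p ]
    inner≡0 = ∑≡0 n middle (λ k k<n →
      mod-trans (mod-* (C≡0 k k<n) (mod-refl (f (suc k)))) (mod-reflexive (ℤP.*-zeroˡ (f (suc k)))))
    clean : ∀ x y → + 1 * x + (+ 0 + + 1 * y) ≡ x + y
    clean = solve-∀

-- Coordinates of powers of √2:  (√2)^k = rat k + irr k · √2.
rat irr : ℕ → ℤ
rat zero    = + 1
rat (suc k) = + 2 * irr k
irr zero    = + 0
irr (suc k) = rat k

-- Coordinates of (1 + √2)^n = E n + O n · √2, defined by the binomial theorem.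
E O : ℕ → ℤ
E = binomialSum rat
O = binomialSum irr

E-suc : ∀ n → E (suc n) ≡ E n + + 2 * O n
E-suc n = trans (binomialSum-suc rat n) (cong (_+_ (E n)) (binomialSum-* (+ 2) irr n))

O-suc : ∀ n → O (suc n) ≡ O n + E n
O-suc = binomialSum-suc irr

rat-irr-even : ∀ j → rat (j ℕ.+ j) ≡ (+ 2) ℤ.^ j × irr (j ℕ.+ j) ≡ + 0
rat-irr-even zero = refl , refl
rat-irr-even (suc j) rewrite ℕP.+-suc j j with rat-irr-even j
... | rat≡2ʲ , irr≡0 =
  cong (_*_ (+ 2)) rat≡2ʲ , trans (cong (_*_ (+ 2)) irr≡0) (ℤP.*-zeroʳ (+ 2))

O-rec : ∀ m → O (suc (suc m)) ≡ + 2 * O (suc m) + O m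
O-rec m = begin
  O (suc (suc m))                 ≡⟨ O-suc (suc m) ⟩
  O (suc m) + E (suc m)           ≡⟨ cong₂ _+_ (O-suc m) (E-suc m) ⟩
  (O m + E m) + (E m + + 2 * O m) ≡⟨ collect (O m) (E m) ⟩
  + 2 * (O m + E m) + O m         ≡⟨ cong (λ x → + 2 * x + O m) (O-suc m) ⟨
  + 2 * O (suc m) + O m           ∎
  where
    open ≡-Reasoning
    collect : ∀ o e → (o + e) + (e + + 2 * o) ≡ + 2 * (o + e) + o
    collect = solve-∀

-- The even powers (1 + √2)^(2n) = (3 + 2√2)^n carry U:
-- O(2n) = 2 U(n)  and  O(2n + 1) = U(n + 1) - U(n).
O-U : ∀ n → O (n ℕ.+ n) ≡ + 2 * U n × O (suc (n ℕ.+ n)) ≡ U (suc n) - U n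
O-U zero = refl , refl
O-U (suc n) rewrite ℕP.+-suc n n with O-U n
... | O-even , O-odd = O-even′ , O-odd′
  where
    O-even′ : O (suc (suc (n ℕ.+ n))) ≡ + 2 * U (suc n)
    O-even′ = trans (O-rec (n ℕ.+ n))
      (trans (cong₂ (λ x y → + 2 * x + y) O-odd O-even) (step (U (suc n)) (U n)))
      where step : ∀ a b → + 2 * (a - b) + + 2 * b ≡ + 2 * a
            step = solve-∀
    O-odd′ : O (suc (suc (suc (n ℕ.+ n)))) ≡ U (suc (suc n)) - U (suc n)
    O-odd′ = trans (O-rec (suc (n ℕ.+ n)))
      (trans (cong₂ (λ x y → + 2 * x + y) O-even′ O-odd) (step (U (suc n)) (U n)))
      where step : ∀ a b → + 2 * (+ 2 * a) + (a - b) ≡ (+ 6 * a - b) - a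
            step = solve-∀

-- Frobenius for 1 + √2: for a prime p = 2h + 1,
-- (1 + √2)^p ≡ (√2)^0 + (√2)^p = 1 + 2^h √2  (mod p).
E-prime : ∀ h → Prime (suc (h ℕ.+ h)) → E (suc (h ℕ.+ h)) ≡ + 1 [mod + suc (h ℕ.+ h) ]
E-prime h isPrime = mod-trans (binomialSum-prime isPrime rat)
  (mod-reflexive (cong (λ x → + 1 + + 2 * x) (proj₂ (rat-irr-even h))))

O-prime : ∀ h → Prime (suc (h ℕ.+ h)) → O (suc (h ℕ.+ h)) ≡ (+ 2) ℤ.^ h [mod + suc (h ℕ.+ h) ]
O-prime h isPrime = mod-trans (binomialSum-prime isPrime irr)
  (mod-reflexive (trans (ℤP.+-identityˡ (rat (h ℕ.+ h))) (proj₁ (rat-irr-even h))))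

module _ {A : Set} where

  ∈-─⁻ : ∀ {xs : List A} {y z} (y∈ : y ∈ xs) → z ∈ (xs ─ y∈) → z ∈ xs
  ∈-─⁻ (here _)   z∈         = there z∈
  ∈-─⁻ (there y∈) (here z≡x) = here z≡x
  ∈-─⁻ (there y∈) (there z∈) = there (∈-─⁻ y∈ z∈)

  ∈-─⁺ : ∀ {xs : List A} {y z} (y∈ : y ∈ xs) → z ∈ xs → z ≢ y → z ∈ (xs ─ y∈)
  ∈-─⁺ (here y≡x)  (here z≡x) z≢y = ⊥-elim (z≢y (trans z≡x (sym y≡x)))
  ∈-─⁺ (here _)    (there z∈) _   = z∈
  ∈-─⁺ (there _)   (here z≡x) _   = here z≡x
  ∈-─⁺ (there y∈)  (there z∈) z≢y = there (∈-─⁺ y∈ z∈ z≢y)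

  ∉-─ : ∀ {xs : List A} {y z} (y∈ : y ∈ xs) → Unique xs → z ∈ (xs ─ y∈) → z ≢ y
  ∉-─ (here refl) (x∉xs ∷ _) z∈          z≡y = All.lookup x∉xs z∈ (sym z≡y)
  ∉-─ (there y∈)  (x∉xs ∷ _) (here refl) z≡y = All.lookup x∉xs y∈ z≡y
  ∉-─ (there y∈)  (_ ∷ xs!)  (there z∈)      = ∉-─ y∈ xs! z∈

  Unique-─ : ∀ {xs : List A} {y} (y∈ : y ∈ xs) → Unique xs → Unique (xs ─ y∈)
  Unique-─ (here _)   (_ ∷ xs!)     = xs!
  Unique-─ (there y∈) (x∉xs ∷ xs!) = All.─⁺ y∈ x∉xs ∷ Unique-─ y∈ xs!

product-─ : ∀ {xs y} (y∈ : y ∈ xs) → product xs ≡ y ℕ.* product (xs ─ y∈)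
product-─ (here refl) = refl
product-─ {x ∷ xs} {y} (there y∈) =
  trans (cong (x ℕ.*_) (product-─ y∈)) (x∙yz≈y∙xz x y (product (xs ─ y∈)))

pos-*-* : ∀ x y m → + (x ℕ.* (y ℕ.* m)) ≡ + x * + y * + m
pos-*-* x y m = trans (ℤP.pos-* x (y ℕ.* m))
                  (trans (cong (+ x *_) (ℤP.pos-* y m)) (sym (ℤP.*-assoc (+ x) (+ y) (+ m))))

-- Arithmetic modulo a prime p, with residues represented by naturals below p.
module PrimeModulus {p : ℕ} (isPrime : Prime p) where

  P : ℤ
  P = + p

  instance
    p-nonZero : ℕ.NonZero p
    p-nonZero = prime⇒nonZero isPrime

  euclid : ∀ {x y} → P ∣ₛ x * y → P ∣ₛ x ⊎ P ∣ₛ y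
  euclid {x} {y} P∣xy
    with euclidsLemma ℤ.∣ x ∣ ℤ.∣ y ∣ isPrime
           (subst (p ∣ℕ_) (ℤP.abs-* x y) (Signed.∣⇒∣ᵤ P∣xy))
  ... | inj₁ p∣x = inj₁ (Signed.∣ᵤ⇒∣ p∣x)
  ... | inj₂ p∣y = inj₂ (Signed.∣ᵤ⇒∣ p∣y)

  reduce : ∀ i → Σ ℕ λ r → r < p × i ≡ + r [mod P ]
  reduce i = i %ℕ p , n%ℕd<d i p , mod (divides (i /ℕ p) (begin
      i - + r                ≡⟨ cong (_- + r) (a≡a%ℕn+[a/ℕn]*n i p) ⟩
      + r + i /ℕ p * P - + r ≡⟨ cancel-r (+ r) (i /ℕ p * P) ⟩
      i /ℕ p * P             ∎))
    where
      open ≡-Reasoning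
      r : ℕ
      r = i %ℕ p
      cancel-r : ∀ r x → r + x - r ≡ x
      cancel-r = solve-∀

  small-multiple : ∀ {d} → d < p → p ∣ℕ d → d ≡ 0
  small-multiple {zero}  _   _   = refl
  small-multiple {suc d} d<p p∣d = ⊥-elim (ℕP.<⇒≱ d<p (ℕD.∣⇒≤ p∣d))

  congruent-above : ∀ {x y} → x ≤ y → y < p → + y ≡ + x [mod P ] → y ≡ x
  congruent-above {x} {y} x≤y y<p (mod P∣y-x) =
    ℕP.≤-antisym (ℕP.m∸n≡0⇒m≤n (small-multiple (ℕP.≤-<-trans (ℕP.m∸n≤m y x) y<p) p∣y∸x)) x≤y
    where
      p∣y∸x : p ∣ℕ y ℕ.∸ x
      p∣y∸x = Signed.∣⇒∣ᵤ (∣-by (sym (trans (ℤP.m-n≡m⊖n y x) (ℤP.⊖-≥ x≤y))) P∣y-x)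

  residue-injective : ∀ {x y} → x < p → y < p → + x ≡ + y [mod P ] → x ≡ y
  residue-injective {x} {y} x<p y<p x≡y with ℕP.≤-total x y
  ... | inj₁ x≤y = sym (congruent-above x≤y y<p (mod-sym x≡y))
  ... | inj₂ y≤x = congruent-above y≤x x<p x≡y

  opposite : ∀ {x y} → 0 < x → x < p → y < p → P ∣ₛ + x + + y → x ℕ.+ y ≡ p
  opposite {x} {y} 0<x x<p y<p P∣x+y with Signed.∣⇒∣ᵤ P∣x+y
  ... | ℕD.divides zero          x+y≡0   =
    ⊥-elim (ℕP.<⇒≱ (ℕP.≤-trans 0<x (ℕP.m≤m+n x y)) (ℕP.≤-reflexive x+y≡0))
  ... | ℕD.divides (suc zero)    x+y≡p   = trans x+y≡p (ℕP.+-identityʳ p)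
  ... | ℕD.divides (suc (suc q)) x+y≡q*p =
    ⊥-elim (ℕP.<⇒≱ (ℕP.+-mono-< x<p y<p)
                   (subst (p ℕ.+ p ≤_) (sym x+y≡q*p) (ℕP.+-monoʳ-≤ p (ℕP.m≤m+n p (q ℕ.* p)))))

  NonzeroResidue : ℕ → Set
  NonzeroResidue x = 0 < x × x < p

  nonzero-∤ : ∀ {x} → NonzeroResidue x → ¬ P ∣ₛ + x
  nonzero-∤ {suc x} (_ , x<p) P∣x = ℕP.<⇒≱ x<p (ℕD.∣⇒≤ (Signed.∣⇒∣ᵤ P∣x))

  cancel : ∀ {c u v} → ¬ P ∣ₛ c → c * u ≡ c * v [mod P ] → u ≡ v [mod P ]
  cancel {c} {u} {v} P∤c (mod P∣cu-cv) with euclid (∣-by (distrib c u v) P∣cu-cv)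
    where distrib : ∀ c u v → c * (u - v) ≡ c * u - c * v
          distrib = solve-∀
  ... | inj₁ P∣c   = ⊥-elim (P∤c P∣c)
  ... | inj₂ P∣u-v = mod P∣u-v

  partner-unique : ∀ {x y y′ a} → NonzeroResidue x → y < p → y′ < p →
                   + x * + y ≡ a [mod P ] → + x * + y′ ≡ a [mod P ] → y ≡ y′
  partner-unique x≢0 y<p y′<p xy≡a xy′≡a =
    residue-injective y<p y′<p (cancel (nonzero-∤ x≢0) (mod-trans xy≡a (mod-sym xy′≡a)))

  square-roots : ∀ {x r} → NonzeroResidue x → NonzeroResidue r →
                 + x * + x ≡ + r * + r [mod P ] → x ≡ r ⊎ x ℕ.+ r ≡ p
  square-roots {x} {r} (0<x , x<p) (_ , r<p) (mod P∣x²-r²)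
    with euclid (∣-by (factor (+ x) (+ r)) P∣x²-r²)
    where factor : ∀ x r → (x - r) * (x + r) ≡ x * x - r * r
          factor = solve-∀
  ... | inj₁ P∣x-r = inj₁ (residue-injective x<p r<p (mod P∣x-r))
  ... | inj₂ P∣x+r = inj₂ (opposite 0<x x<p r<p P∣x+r)

  inverse : ∀ {x} → NonzeroResidue x → Σ ℤ λ t → + x * t ≡ + 1 [mod P ]
  inverse {x@(suc _)} (_ , x<p) with coprime-Bézout (prime⇒coprime isPrime x<p)
  ... | ℕGCD.Bézout.+- u v 1+vx≡up = - + v , mod (divides (- + u) (begin
      + x * - + v - + 1     ≡⟨ negate (+ x) (+ v) ⟩
      - (+ 1 + + v * + x)   ≡⟨ cong -_ (lift-eq 1+vx≡up) ⟩
      - (+ u * P)           ≡⟨ ℤP.neg-distribˡ-* (+ u) P ⟩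
      - + u * P             ∎))
    where
      open ≡-Reasoning
      negate : ∀ x v → x * - v - + 1 ≡ - (+ 1 + v * x)
      negate = solve-∀
      lift-eq : 1 ℕ.+ v ℕ.* x ≡ u ℕ.* p → + 1 + + v * + x ≡ + u * P
      lift-eq eq = trans (cong (λ z → + 1 + z) (sym (ℤP.pos-* v x)))
                         (trans (cong +_ eq) (ℤP.pos-* u p))
  ... | ℕGCD.Bézout.-+ u v 1+up≡vx = + v , mod (divides (+ u) (begin
      + x * + v - + 1       ≡⟨ cong (_- + 1) (ℤP.*-comm (+ x) (+ v)) ⟩
      + v * + x - + 1       ≡⟨ cong (_- + 1) (lift-eq 1+up≡vx) ⟨
      + 1 + + u * P - + 1   ≡⟨ cancel-one (+ u * P) ⟩
      + u * P               ∎))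
    where
      open ≡-Reasoning
      cancel-one : ∀ y → + 1 + y - + 1 ≡ y
      cancel-one = solve-∀
      lift-eq : 1 ℕ.+ u ℕ.* p ≡ v ℕ.* x → + 1 + + u * P ≡ + v * + x
      lift-eq eq = trans (cong (λ z → + 1 + z) (sym (ℤP.pos-* u p)))
                         (trans (cong +_ eq) (ℤP.pos-* v x))

  divide : ∀ {x c} → NonzeroResidue x → ¬ P ∣ₛ c →
           Σ ℕ λ y → NonzeroResidue y × + x * + y ≡ c [mod P ]
  divide {x} {c} x≢0 P∤c with inverse x≢0
  ... | t , xt≡1 = solution (reduce (t * c))
    where
      c≡x[tc] : c ≡ + x * (t * c) [mod P ]
      c≡x[tc] = begin
        c             ≡⟨ ℤP.*-identityˡ c ⟨
        + 1 * c       ≈⟨ mod-* (mod-sym xt≡1) (mod-refl c) ⟩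
        + x * t * c   ≡⟨ ℤP.*-assoc (+ x) t c ⟩
        + x * (t * c) ∎
        where open ≡-mod-Reasoning P
      solution : Σ ℕ (λ r → r < p × t * c ≡ + r [mod P ]) →
                 Σ ℕ λ y → NonzeroResidue y × + x * + y ≡ c [mod P ]
      solution (zero , _ , tc≡0) = ⊥-elim (P∤c (≡0⇒∣ (mod-trans c≡x[tc]
        (mod-trans (mod-* (mod-refl (+ x)) tc≡0) (mod-reflexive (ℤP.*-zeroʳ (+ x)))))))
      solution (suc y , y<p , tc≡y) = suc y , (ℕ.s≤s ℕ.z≤n , y<p) ,
        mod-trans (mod-* (mod-refl (+ x)) (mod-sym tc≡y)) (mod-sym c≡x[tc])

double≢odd : ∀ m n → m ℕ.+ m ≢ suc (n ℕ.+ n)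
double≢odd m n eq = ℕP.even≢odd m n (trans (twice m) (trans eq (cong suc (sym (twice n)))))
  where twice : ∀ k → 2 ℕ.* k ≡ k ℕ.+ k
        twice k = cong (k ℕ.+_) (ℕP.+-identityʳ k)

double-injective : ∀ {m n} → m ℕ.+ m ≡ n ℕ.+ n → m ≡ n
double-injective {m} {n} eq =
  trans (ℕP.n≡⌊n+n/2⌋ m) (trans (cong ℕ.⌊_/2⌋ eq) (sym (ℕP.n≡⌊n+n/2⌋ n)))

parity : ∀ n → Σ ℕ λ h → n ≡ h ℕ.+ h ⊎ n ≡ suc (h ℕ.+ h)
parity zero = 0 , inj₁ refl
parity (suc n) with parity n
... | h , inj₁ n≡2h   = h , inj₂ (cong suc n≡2h)
... | h , inj₂ n≡2h+1 = suc h , inj₁ (cong suc (trans n≡2h+1 (sym (ℕP.+-suc h h))))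

odd-prime : ∀ p → Prime p → p ≢ 2 → Σ ℕ λ h → p ≡ suc (h ℕ.+ h)
odd-prime p isPrime p≢2 with parity p
... | h , inj₂ p≡2h+1 = h , p≡2h+1
... | h , inj₁ p≡2h with prime⇒irreducible isPrime (ℕD.divides h (trans p≡2h (twice h)))
  where twice : ∀ h → h ℕ.+ h ≡ h ℕ.* 2
        twice = ℕSolver.solve-∀
...   | inj₁ ()
...   | inj₂ 2≡p = ⊥-elim (p≢2 (sym 2≡p))

odd-prime-half : ∀ h → Prime (suc (h ℕ.+ h)) → 1 ≤ h
odd-prime-half zero    isPrime = ⊥-elim (¬prime[1] isPrime)
odd-prime-half (suc _) _       = ℕ.s≤s ℕ.z≤n

module OddPrime (h : ℕ) (isPrime : Prime (suc (h ℕ.+ h))) where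

  open PrimeModulus isPrime

  p : ℕ
  p = suc (h ℕ.+ h)

  h≥1 : 1 ≤ h
  h≥1 = odd-prime-half h isPrime

  P∤2 : ¬ P ∣ₛ + 2
  P∤2 P∣2 = ℕP.<⇒≱ (ℕ.s≤s (ℕP.+-mono-≤ h≥1 h≥1)) (ℕD.∣⇒≤ (Signed.∣⇒∣ᵤ P∣2))

  residues : List ℕ
  residues = applyUpTo suc (h ℕ.+ h)

  ∈-residues : ∀ {x} → NonzeroResidue x → x ∈ residues
  ∈-residues {suc x} (_ , ℕ.s≤s x<2h) = ∈-applyUpTo⁺ suc x<2h

  residues-nonzero : ∀ {x} → x ∈ residues → NonzeroResidue x
  residues-nonzero x∈ with ∈-applyUpTo⁻ suc x∈
  ... | _ , i<2h , refl = ℕ.s≤s ℕ.z≤n , ℕ.s≤s i<2h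

  residues-unique : Unique residues
  residues-unique = applyUpTo⁺₁ suc (h ℕ.+ h) (λ i<j _ → ℕP.<⇒≢ i<j ∘ ℕP.suc-injective)

  -- L can be paired off against a: its elements are distinct nonzero
  -- residues, L contains the solution y of x y ≡ a for each of its
  -- elements x, and no element of L is a square root of a (so y ≠ x).
  record Pairing (a : ℤ) (L : List ℕ) : Set where
    field
      unique   : Unique L
      nonzero  : ∀ {x} → x ∈ L → NonzeroResidue x
      closed   : ∀ {x y} → x ∈ L → NonzeroResidue y → + x * + y ≡ a [mod P ] → y ∈ L
      rootless : ∀ {x} → x ∈ L → ¬ (+ x * + x ≡ a [mod P ])

  -- Removing a pair {x, y} with x y ≡ a from a pairable list keeps it
  -- pairable: the partner of any remaining z is neither x (else z = y) nor
  -- y (else z = x).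
  remove-pair : ∀ {a x y R} → Pairing a (x ∷ R) → + x * + y ≡ a [mod P ] →
                (y∈R : y ∈ R) → Pairing a (R ─ y∈R)
  remove-pair {a} {x} {y} {R} L-pairs xy≡a y∈R = record
    { unique   = Unique-─ y∈R R!
    ; nonzero  = nonzero ∘ there ∘ ∈-─⁻ y∈R
    ; closed   = closed′
    ; rootless = rootless ∘ there ∘ ∈-─⁻ y∈R
    }
    where
      open Pairing L-pairs
      x∉R : All (x ≢_) R
      x∉R with unique
      ... | x∉R ∷ _ = x∉R
      R! : Unique R
      R! with unique
      ... | _ ∷ R! = R!
      x≢0 : NonzeroResidue x
      x≢0 = nonzero (here refl)
      y≢0 : NonzeroResidue y
      y≢0 = nonzero (there y∈R)
      closed′ : ∀ {z w} → z ∈ (R ─ y∈R) → NonzeroResidue w → + z * + w ≡ a [mod P ] →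
                w ∈ (R ─ y∈R)
      closed′ {z} {w} z∈R′ w≢0 zw≡a with closed (there z∈R) w≢0 zw≡a
        where z∈R : z ∈ R
              z∈R = ∈-─⁻ y∈R z∈R′
      ... | here refl = ⊥-elim (∉-─ y∈R R! z∈R′ z≡y)
        where
          z≡y : z ≡ y
          z≡y = partner-unique x≢0 (proj₂ (nonzero (there (∈-─⁻ y∈R z∈R′)))) (proj₂ y≢0)
                  (mod-*-comm (+ z) (+ x) zw≡a) xy≡a
      ... | there w∈R = ∈-─⁺ y∈R w∈R w≢y
        where
          w≢y : w ≢ y
          w≢y refl = All.lookup x∉R (∈-─⁻ y∈R z∈R′) (sym z≡x)
            where
              z≡x : z ≡ x
              z≡x = partner-unique y≢0 (proj₂ (nonzero (there (∈-─⁻ y∈R z∈R′)))) (proj₂ x≢0)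
                      (mod-*-comm (+ z) (+ y) zw≡a) (mod-*-comm (+ x) (+ y) xy≡a)

  -- A pairable list has even length 2k, and its product is a^k: pair its
  -- head x with its partner y, remove both, and recurse (on a bound n for
  -- the length, which drops by two).
  pair-off : ∀ {a} → ¬ P ∣ₛ a → ∀ L → Pairing a L →
             Σ ℕ λ k → (k ℕ.+ k ≡ length L) × (+ product L ≡ a ℤ.^ k [mod P ])
  pair-off {a} P∤a L = go (length L) L ℕP.≤-refl
    where
      go : ∀ n L → length L ≤ n → Pairing a L →
           Σ ℕ λ k → (k ℕ.+ k ≡ length L) × (+ product L ≡ a ℤ.^ k [mod P ])
      go _       []      _   _       = 0 , refl , mod-refl (+ 1)
      go (suc n) (x ∷ R) (ℕ.s≤s |R|≤n) L-pairs
        with divide (Pairing.nonzero L-pairs (here refl)) P∤a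
      ... | y , y≢0 , xy≡a with Pairing.closed L-pairs (here refl) y≢0 xy≡a
      ...   | here refl = ⊥-elim (Pairing.rootless L-pairs (here refl) xy≡a)
      ...   | there y∈R with go n (R ─ y∈R) |R′|≤n (remove-pair L-pairs xy≡a y∈R)
        where
          |R|≡1+|R′| : length R ≡ suc (length (R ─ y∈R))
          |R|≡1+|R′| = length-removeAt′ R (index y∈R)
          |R′|≤n : length (R ─ y∈R) ≤ n
          |R′|≤n = ℕP.≤-trans (ℕP.n≤1+n _) (subst (_≤ n) |R|≡1+|R′| |R|≤n)
      ...     | k , k+k≡|R′| , ΠR′≡aᵏ = suc k , length-eq , product-eq
        where
          open ≡-mod-Reasoning P
          R′ : List ℕ
          R′ = R ─ y∈R
          length-eq : suc k ℕ.+ suc k ≡ suc (length R)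
          length-eq = cong suc (trans (ℕP.+-suc k k)
                        (trans (cong suc k+k≡|R′|) (sym (length-removeAt′ R (index y∈R)))))
          product-eq : + product (x ∷ R) ≡ a ℤ.^ suc k [mod P ]
          product-eq = begin
            + (x ℕ.* product R)              ≡⟨ cong (λ m → + (x ℕ.* m)) (product-─ y∈R) ⟩
            + (x ℕ.* (y ℕ.* product R′))     ≡⟨ pos-*-* x y (product R′) ⟩
            + x * + y * + product R′         ≈⟨ mod-* xy≡a ΠR′≡aᵏ ⟩
            a * a ℤ.^ k                      ∎

  -- If a is not a square modulo p, the residues pair off as {x, a/x}:
  -- (p - 1)! ≡ a^h.
  product-nonsquare : ∀ {a} → ¬ P ∣ₛ a → (∀ x → ¬ (+ x * + x ≡ a [mod P ])) →
                      + product residues ≡ a ℤ.^ h [mod P ]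
  product-nonsquare {a} P∤a nonsquare with pair-off P∤a residues (record
    { unique   = residues-unique
    ; nonzero  = residues-nonzero
    ; closed   = λ _ y≢0 _ → ∈-residues y≢0
    ; rootless = λ {x} _ → nonsquare x
    })
  ... | k , k+k≡2h , Π≡aᵏ = subst (λ j → + product residues ≡ a ℤ.^ j [mod P ]) k≡h Π≡aᵏ
    where k≡h : k ≡ h
          k≡h = double-injective (trans k+k≡2h (length-applyUpTo suc (h ℕ.+ h)))

  -- If a ≡ r², the residues other than the square roots r and t = p - r
  -- of a pair off as above, and r t ≡ -a:  (p - 1)! ≡ -a^h.
  product-square : ∀ {a r} → NonzeroResidue r → + r * + r ≡ a [mod P ] →
                   + product residues ≡ - a ℤ.^ h [mod P ]
  product-square {a} {r} r≢0@(0<r , r<p) r²≡a = conclude (pair-off P∤a L L-pairs)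
    where
      t : ℕ
      t = p ℕ.∸ r
      r+t≡p : r ℕ.+ t ≡ p
      r+t≡p = ℕP.m+[n∸m]≡n (ℕP.<⇒≤ r<p)
      t≢0 : NonzeroResidue t
      t≢0 = ℕP.m<n⇒0<n∸m r<p , ℕP.∸-monoʳ-< 0<r (ℕP.<⇒≤ r<p)
      r≢t : r ≢ t
      r≢t r≡t = double≢odd r h (trans (cong (r ℕ.+_) r≡t) r+t≡p)
      P∣r+t : P ∣ₛ + r + + t
      P∣r+t = ∣-by (cong +_ r+t≡p) (Signed.∣-refl {P})
      t²≡a : + t * + t ≡ a [mod P ]
      t²≡a = mod-combination (+ t - + r) (+ 1) (identity (+ r) (+ t) a)
                             P∣r+t (modulus-divides r²≡a)
        where identity : ∀ r t a → t * t - a ≡ (t - r) * (r + t) + + 1 * (r * r - a)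
              identity = solve-∀
      tr≡-a : + t * + r ≡ - a [mod P ]
      tr≡-a = mod-combination (+ r) (- + 1) (identity (+ r) (+ t) a)
                              P∣r+t (modulus-divides r²≡a)
        where identity : ∀ r t a → t * r - - a ≡ r * (r + t) + - + 1 * (r * r - a)
              identity = solve-∀
      P∤a : ¬ P ∣ₛ a
      P∤a P∣a with euclid (≡0⇒∣ (mod-trans r²≡a (∣⇒≡0 P∣a)))
      ... | inj₁ P∣r = nonzero-∤ r≢0 P∣r
      ... | inj₂ P∣r = nonzero-∤ r≢0 P∣r

      t∈ : t ∈ residues
      t∈ = ∈-residues t≢0
      L₁ : List ℕ
      L₁ = residues ─ t∈
      r∈L₁ : r ∈ L₁
      r∈L₁ = ∈-─⁺ t∈ (∈-residues r≢0) r≢t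
      L : List ℕ
      L = L₁ ─ r∈L₁
      |residues|≡2+|L| : length residues ≡ suc (suc (length L))
      |residues|≡2+|L| = trans (length-removeAt′ residues (index t∈))
                               (cong suc (length-removeAt′ L₁ (index r∈L₁)))
      L₁! : Unique L₁
      L₁! = Unique-─ t∈ residues-unique
      L⊆residues : ∀ {z} → z ∈ L → z ∈ residues
      L⊆residues = ∈-─⁻ t∈ ∘ ∈-─⁻ r∈L₁
      z<p : ∀ {z} → z ∈ L → z < p
      z<p = proj₂ ∘ residues-nonzero ∘ L⊆residues
      not-partner : ∀ {x z} → NonzeroResidue x → + x * + x ≡ a [mod P ] → z ∈ L →
                    + z * + x ≡ a [mod P ] → z ≡ x
      not-partner {x} {z} x≢0 x²≡a z∈L zx≡a =
        partner-unique x≢0 (z<p z∈L) (proj₂ x≢0) (mod-*-comm (+ z) (+ x) zx≡a) x²≡a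
      z≢r : ∀ {z} → z ∈ L → z ≢ r
      z≢r = ∉-─ r∈L₁ L₁!
      z≢t : ∀ {z} → z ∈ L → z ≢ t
      z≢t z∈L = ∉-─ t∈ residues-unique (∈-─⁻ r∈L₁ z∈L)
      L-closed : ∀ {z w} → z ∈ L → NonzeroResidue w → + z * + w ≡ a [mod P ] → w ∈ L
      L-closed {z} {w} z∈L w≢0 zw≡a = ∈-─⁺ r∈L₁ (∈-─⁺ t∈ (∈-residues w≢0) w≢t) w≢r
        where
          w≢t : w ≢ t
          w≢t refl = z≢t z∈L (not-partner t≢0 t²≡a z∈L zw≡a)
          w≢r : w ≢ r
          w≢r refl = z≢r z∈L (not-partner r≢0 r²≡a z∈L zw≡a)
      -- The square roots of a are r and t, both removed.
      L-rootless : ∀ {z} → z ∈ L → ¬ (+ z * + z ≡ a [mod P ])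
      L-rootless {z} z∈L z²≡a = [ z≢r z∈L , z≢t z∈L ∘ z≡t ]′
        (square-roots (residues-nonzero (L⊆residues z∈L)) r≢0 (mod-trans z²≡a (mod-sym r²≡a)))
        where z≡t : z ℕ.+ r ≡ p → z ≡ t
              z≡t z+r≡p = ℕP.+-cancelʳ-≡ r z t (trans z+r≡p (trans (sym r+t≡p) (ℕP.+-comm r t)))
      L-pairs : Pairing a L
      L-pairs = record
        { unique   = Unique-─ r∈L₁ L₁!
        ; nonzero  = residues-nonzero ∘ L⊆residues
        ; closed   = L-closed
        ; rootless = L-rootless
        }
      conclude : Σ ℕ (λ k → (k ℕ.+ k ≡ length L) × (+ product L ≡ a ℤ.^ k [mod P ])) →
                 + product residues ≡ - a ℤ.^ h [mod P ]
      conclude (k , k+k≡|L| , ΠL≡aᵏ) =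
        subst (λ j → + product residues ≡ - a ℤ.^ j [mod P ]) 1+k≡h (begin
          + product residues
            ≡⟨ cong +_ (trans (product-─ t∈) (cong (t ℕ.*_) (product-─ r∈L₁))) ⟩
          + (t ℕ.* (r ℕ.* product L))      ≡⟨ pos-*-* t r (product L) ⟩
          + t * + r * + product L          ≈⟨ mod-* tr≡-a ΠL≡aᵏ ⟩
          - a * a ℤ.^ k                    ≡⟨ ℤP.neg-distribˡ-* a (a ℤ.^ k) ⟨
          - a ℤ.^ suc k                    ∎)
        where
          open ≡-mod-Reasoning P
          1+k≡h : suc k ≡ h
          1+k≡h = double-injective (trans (cong suc (trans (ℕP.+-suc k k) (cong suc k+k≡|L|)))
                    (trans (sym |residues|≡2+|L|) (length-applyUpTo suc (h ℕ.+ h))))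

  -- Wilson's theorem: (p - 1)! ≡ -1, the case a = r = 1 of product-square.
  wilson : + product residues ≡ - + 1 [mod P ]
  wilson = mod-trans (product-square 1≢0 (mod-refl (+ 1)))
                     (mod-reflexive (cong -_ (ℤP.^-zeroˡ h)))
    where 1≢0 : NonzeroResidue 1
          1≢0 = ℕ.s≤s ℕ.z≤n , ℕ.s≤s (ℕP.≤-trans h≥1 (ℕP.m≤m+n h h))

  -- Euler's criterion for 2: 2^h ≡ (2/p)  (mod p).  Compare (p - 1)! ≡ -1
  -- with (p - 1)! ≡ -2^h (2 a square) or (p - 1)! ≡ 2^h (2 not a square).
  euler : ∀ {s} → Legendre2 p s → (+ 2) ℤ.^ h ≡ s [mod P ]
  euler (residue (x , p∣x²-2)) with reduce x
  ... | zero , _ , x≡0 = ⊥-elim (P∤2 (≡0⇒∣ (mod-trans (mod-sym x²≡2) (mod-* x≡0 x≡0))))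
    where x²≡2 = mod (Signed.∣ᵤ⇒∣ p∣x²-2)
  ... | suc r , r<p , x≡r = begin
      (+ 2) ℤ.^ h          ≡⟨ ℤP.neg-involutive ((+ 2) ℤ.^ h) ⟨
      - (- (+ 2) ℤ.^ h)    ≈⟨ mod-neg (mod-trans (mod-sym (product-square r≢0 r²≡2)) wilson) ⟩
      - (- + 1)            ≡⟨⟩
      + 1                  ∎
    where
      open ≡-mod-Reasoning P
      r≢0 : NonzeroResidue (suc r)
      r≢0 = ℕ.s≤s ℕ.z≤n , r<p
      r²≡2 : + suc r * + suc r ≡ + 2 [mod P ]
      r²≡2 = mod-trans (mod-sym (mod-* x≡r x≡r)) (mod (Signed.∣ᵤ⇒∣ p∣x²-2))
  euler (nonresidue ¬qr) = mod-trans (mod-sym (product-nonsquare P∤2 nonsquare)) wilson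
    where nonsquare : ∀ x → ¬ (+ x * + x ≡ + 2 [mod P ])
          nonsquare x x²≡2 = ¬qr (+ x , Signed.∣⇒∣ᵤ (modulus-divides x²≡2))

  halve : ∀ {u} → P ∣ₛ + 2 * u → P ∣ₛ u
  halve P∣2u with euclid P∣2u
  ... | inj₁ P∣2 = ⊥-elim (P∤2 P∣2)
  ... | inj₂ P∣u = P∣u

  -- The base case: p divides U(m) for m = (p - (2/p)) / 2.  With
  -- (1 + √2)^p ≡ 1 + (2/p) √2, this is O(p - 1) = E(p) - O(p) ≡ 0 for
  -- (2/p) = 1 and O(p + 1) = O(p) + E(p) ≡ 0 for (2/p) = -1; and O(2m) = 2 U(m).
  half-index : ∀ {s} → Legendre2 p s → Σ ℕ λ m → (P ∣ₛ U m) × (+ m + + m ≡ P - s)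
  half-index legendre@(residue _) = h , halve (≡0⇒∣ 2U[h]≡0) , refl
    where
      open ≡-mod-Reasoning P
      e o : ℤ
      e = E (h ℕ.+ h)
      o = O (h ℕ.+ h)
      2U[h]≡0 : + 2 * U h ≡ + 0 [mod P ]
      2U[h]≡0 = begin
        + 2 * U h                 ≡⟨ proj₁ (O-U h) ⟨
        o                         ≡⟨ difference e o ⟩
        (e + + 2 * o) - (o + e)   ≡⟨ cong₂ _-_ (E-suc (h ℕ.+ h)) (O-suc (h ℕ.+ h)) ⟨
        E p - O p
          ≈⟨ mod-- (E-prime h isPrime) (mod-trans (O-prime h isPrime) (euler legendre)) ⟩
        + 1 - + 1                 ≡⟨⟩
        + 0                       ∎
        where difference : ∀ e o → o ≡ (e + + 2 * o) - (o + e)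
              difference = solve-∀
  half-index legendre@(nonresidue _) = suc h , halve (≡0⇒∣ 2U[h+1]≡0) , cong +_ index-eq
    where
      open ≡-mod-Reasoning P
      index-eq : suc h ℕ.+ suc h ≡ p ℕ.+ 1
      index-eq = trans (cong suc (ℕP.+-suc h h)) (ℕP.+-comm 1 p)
      2U[h+1]≡0 : + 2 * U (suc h) ≡ + 0 [mod P ]
      2U[h+1]≡0 = begin
        + 2 * U (suc h)           ≡⟨ proj₁ (O-U (suc h)) ⟨
        O (suc h ℕ.+ suc h)       ≡⟨ cong O (cong suc (ℕP.+-suc h h)) ⟩
        O (suc p)                 ≡⟨ O-suc p ⟩
        O p + E p
          ≈⟨ mod-+ (mod-trans (O-prime h isPrime) (euler legendre)) (E-prime h isPrime) ⟩
        - + 1 + + 1               ≡⟨⟩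
        + 0                       ∎

lemma4 : (p b : ℕ) → Prime p → p ≢ 2 → 1 ≤ b →
    (s : ℤ) → Legendre2 p s →
    (z : ℕ) → IsIndexOfAppearance (p ^ b) z →
    (N : ℤ) → + 2 * N ≡ + (p ^ (b ∸ 1)) * (+ p - s) →
    (+ z) ∣ N
lemma4 p zero    _       _   ()
lemma4 p (suc b) isPrime p≢2 _ s legendre z z-index N 2N≡pᵇ[p-s] with odd-prime p isPrime p≢2
... | h , refl with OddPrime.half-index h isPrime legendre
...   | m , p∣U[m] , 2m≡p-s = subst (+ z ∣_) (sym N≡pᵇm) z∣pᵇm
  where
    z∣pᵇm : z ∣ℕ p ^ b ℕ.* m
    z∣pᵇm = appearance-divides (p ^ b ℕ.* m) z-index (Signed.∣⇒∣ᵤ (lift p m b p∣U[m]))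
    N≡pᵇm : N ≡ + (p ^ b ℕ.* m)
    N≡pᵇm = ℤP.*-cancelˡ-≡ (+ 2) N (+ (p ^ b ℕ.* m)) (begin
      + 2 * N                      ≡⟨ 2N≡pᵇ[p-s] ⟩
      + (p ^ b) * (+ p - s)        ≡⟨ cong (_*_ (+ (p ^ b))) 2m≡p-s ⟨
      + (p ^ b) * (+ m + + m)      ≡⟨ double (+ (p ^ b)) (+ m) ⟩
      + 2 * (+ (p ^ b) * + m)      ≡⟨ cong (_*_ (+ 2)) (ℤP.pos-* (p ^ b) m) ⟨
      + 2 * + (p ^ b ℕ.* m)        ∎)
      where
        open ≡-Reasoning
        double : ∀ a m → a * (m + m) ≡ + 2 * (a * m)
        double = solve-∀
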